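{- Let $U,V$ be theories in the same language. (a) If $U\Subset V$, then $\widehat U\subseteq U_{\mathfrak p}$, every element of $U_{\mathfrak p}\Cup V$ is mono-derivable from $U_{\mathfrak p}$... more precisely: $\widehat U\subseteq U_{\mathfrak p}$, $U_{\mathfrak p}\subseteq_{\mathfrak m}U_{\mathfrak p}\Cup V$, and $U_{\mathfrak p}\Cup V\subseteq_{\mathfrak m}V$. (b) If $U\Subset V$ and $V$ is mono-consistent, then $V_{\mathfrak m}$ and $V_{\mathfrak n}$ weakly biseparate $U_{\mathfrak p}$ and $U_{\mathfrak r}$. (c) $U\Subset U$ if and only if $U_{\mathfrak m}=U_{\mathfrak p}$.
   Context: $T_{\mathfrak p}$ is the set of theorems of $T$, $T_{\mathfrak r}=\{\phi\mid T\vdash\neg\phi\}$. For sets of sentences $A,B$ (same language): $A\subseteq_{\mathfrak m}B$ iff for every $a\in A$ there is $b\in B$ with $b\vdash a$; $B_{\mathfrak m}=\{\phi\mid\exists\psi\in B\ \psi\vdash\phi\}$; $B_{\mathfrak n}=\{\phi\mid\exists\psi\in B\ \psi\vdash\neg\phi\}$; $B$ is mono-consistent iff no element of $B$ is inconsistent. $\widehat U$ is the set of all non-empty finite conjunctions of elements of $U$. $A\Cup B=\{\phi\wedge\psi\mid\phi\in A,\psi\in B\}$, and $U\Subset V$ iff $U\Cup V\subseteq_{\mathfrak m}V$. Sets $\mathcal Z,\mathcal W$ weakly biseparate $\mathcal A,\mathcal B$ iff $\mathcal A\subseteq\mathcal Z$, $\mathcal B\subseteq\mathcal W$, $\mathcal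 Z\cap\mathcal B=\emptyset$ and $\mathcal W\cap\mathcal A=\emptyset$. -}

module Defs where

open import Data.Nat using (ℕ; zero; suc)
open import Data.Fin using (Fin; zero; suc)
open import Data.Vec using (Vec; []; _∷_)
open import Data.List using (List; []; _∷_; [_]; map)
open import Data.List.Membership.Propositional using (_∈_)
open import Data.List.Relation.Unary.All using (All)
open import Data.Product using (Σ; ∃; ∃-syntax; _×_; _,_)
open import Relation.Binary.PropositionalEquality using (_≡_)
open import Relation.Unary using (Pred; _⊆_; _≐_)
open import Data.Empty using (⊥)
open import Level using (0ℓ)

record Signature : Set₁ where
  field
    Func : ℕ → Set
    Rel  : ℕ → Set

module FOL (L : Signature) where
  open Signature L

  -- terms with de Bruijn variables (n = number of free variables)
  data Term (n : ℕ) : Set where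
    var : Fin n → Term n
    fun : ∀ {k} → Func k → Vec (Term n) k → Term n

  infixr 30 _⇒_
  infixr 40 _∧_ _∨_
  infix  50 _≐ₜ_

  data Formula (n : ℕ) : Set where
    ⊥'    : Formula n
    rel   : ∀ {k} → Rel k → Vec (Term n) k → Formula n
    _≐ₜ_  : Term n → Term n → Formula n
    _⇒_   : Formula n → Formula n → Formula n
    _∧_   : Formula n → Formula n → Formula n
    _∨_   : Formula n → Formula n → Formula n
    ∀'    : Formula (suc n) → Formula n
    ∃'    : Formula (suc n) → Formula n

  ¬' : ∀ {n} → Formula n → Formula n
  ¬' φ = φ ⇒ ⊥'

  Sentence : Set
  Sentence = Formula 0

  Ren : ℕ → ℕ → Set
  Ren n m = Fin n → Fin m

  liftR : ∀ {n m} → Ren n m → Ren (suc n) (suc m)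
  liftR ρ zero    = zero
  liftR ρ (suc i) = suc (ρ i)

  mutual
    renT : ∀ {n m} → Ren n m → Term n → Term m
    renT ρ (var i)    = var (ρ i)
    renT ρ (fun f ts) = fun f (renTs ρ ts)

    renTs : ∀ {n m k} → Ren n m → Vec (Term n) k → Vec (Term m) k
    renTs ρ []       = []
    renTs ρ (t ∷ ts) = renT ρ t ∷ renTs ρ ts

  renF : ∀ {n m} → Ren n m → Formula n → Formula m
  renF ρ ⊥'         = ⊥'
  renF ρ (rel R ts) = rel R (renTs ρ ts)
  renF ρ (t ≐ₜ s)   = renT ρ t ≐ₜ renT ρ s
  renF ρ (φ ⇒ ψ)    = renF ρ φ ⇒ renF ρ ψ
  renF ρ (φ ∧ ψ)    = renF ρ φ ∧ renF ρ ψ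
  renF ρ (φ ∨ ψ)    = renF ρ φ ∨ renF ρ ψ
  renF ρ (∀' φ)     = ∀' (renF (liftR ρ) φ)
  renF ρ (∃' φ)     = ∃' (renF (liftR ρ) φ)

  wk : ∀ {n} → Formula n → Formula (suc n)
  wk = renF suc

  Sub : ℕ → ℕ → Set
  Sub n m = Fin n → Term m

  liftS : ∀ {n m} → Sub n m → Sub (suc n) (suc m)
  liftS σ zero    = var zero
  liftS σ (suc i) = renT suc (σ i)

  mutual
    subT : ∀ {n m} → Sub n m → Term n → Term m
    subT σ (var i)    = σ i
    subT σ (fun f ts) = fun f (subTs σ ts)

    subTs : ∀ {n m k} → Sub n m → Vec (Term n) k → Vec (Term m) k
    subTs σ []       = []
    subTs σ (t ∷ ts) = subT σ t ∷ subTs σ ts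

  subF : ∀ {n m} → Sub n m → Formula n → Formula m
  subF σ ⊥'         = ⊥'
  subF σ (rel R ts) = rel R (subTs σ ts)
  subF σ (t ≐ₜ s)   = subT σ t ≐ₜ subT σ s
  subF σ (φ ⇒ ψ)    = subF σ φ ⇒ subF σ ψ
  subF σ (φ ∧ ψ)    = subF σ φ ∧ subF σ ψ
  subF σ (φ ∨ ψ)    = subF σ φ ∨ subF σ ψ
  subF σ (∀' φ)     = ∀' (subF (liftS σ) φ)
  subF σ (∃' φ)     = ∃' (subF (liftS σ) φ)

  inst : ∀ {n} → Formula (suc n) → Term n → Formula n
  inst φ t = subF (λ { zero → t ; (suc i) → var i }) φ

  infix 10 _⊢_

  data _⊢_ : ∀ {n} → List (Formula n) → Formula n → Set where
    hyp   : ∀ {n} {Γ : List (Formula n)} {φ} → φ ∈ Γ → Γ ⊢ φ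
    ⊥E    : ∀ {n} {Γ : List (Formula n)} {φ} → Γ ⊢ ⊥' → Γ ⊢ φ
    raa   : ∀ {n} {Γ : List (Formula n)} {φ} → (¬' φ ∷ Γ) ⊢ ⊥' → Γ ⊢ φ
    ⇒I    : ∀ {n} {Γ : List (Formula n)} {φ ψ} → (φ ∷ Γ) ⊢ ψ → Γ ⊢ φ ⇒ ψ
    ⇒E    : ∀ {n} {Γ : List (Formula n)} {φ ψ} → Γ ⊢ φ ⇒ ψ → Γ ⊢ φ → Γ ⊢ ψ
    ∧I    : ∀ {n} {Γ : List (Formula n)} {φ ψ} → Γ ⊢ φ → Γ ⊢ ψ → Γ ⊢ φ ∧ ψ
    ∧E₁   : ∀ {n} {Γ : List (Formula n)} {φ ψ} → Γ ⊢ φ ∧ ψ → Γ ⊢ φ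
    ∧E₂   : ∀ {n} {Γ : List (Formula n)} {φ ψ} → Γ ⊢ φ ∧ ψ → Γ ⊢ ψ
    ∨I₁   : ∀ {n} {Γ : List (Formula n)} {φ ψ} → Γ ⊢ φ → Γ ⊢ φ ∨ ψ
    ∨I₂   : ∀ {n} {Γ : List (Formula n)} {φ ψ} → Γ ⊢ ψ → Γ ⊢ φ ∨ ψ
    ∨E    : ∀ {n} {Γ : List (Formula n)} {φ ψ χ} →
            Γ ⊢ φ ∨ ψ → (φ ∷ Γ) ⊢ χ → (ψ ∷ Γ) ⊢ χ → Γ ⊢ χ
    ∀I    : ∀ {n} {Γ : List (Formula n)} {φ} → map wk Γ ⊢ φ → Γ ⊢ ∀' φ
    ∀E    : ∀ {n} {Γ : List (Formula n)} {φ} → Γ ⊢ ∀' φ → (t : Term n) → Γ ⊢ inst φ t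
    ∃I    : ∀ {n} {Γ : List (Formula n)} {φ} (t : Term n) → Γ ⊢ inst φ t → Γ ⊢ ∃' φ
    ∃E    : ∀ {n} {Γ : List (Formula n)} {φ ψ} →
            Γ ⊢ ∃' φ → (φ ∷ map wk Γ) ⊢ wk ψ → Γ ⊢ ψ
    ≐refl : ∀ {n} {Γ : List (Formula n)} {t} → Γ ⊢ t ≐ₜ t
    ≐subst : ∀ {n} {Γ : List (Formula n)} {φ t s} →
            Γ ⊢ t ≐ₜ s → Γ ⊢ inst φ t → Γ ⊢ inst φ s

  SentSet : Set₁
  SentSet = Pred Sentence 0ℓ

  _⊩_ : SentSet → Sentence → Set
  T ⊩ φ = ∃[ Δ ] (All T Δ × (Δ ⊢ φ))

  _⊢₁_ : Sentence → Sentence → Set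
  ψ ⊢₁ φ = [ ψ ] ⊢ φ

  -- T_p : theorems of T
  Thm : SentSet → SentSet
  Thm T φ = T ⊩ φ

  -- T_r : sentences refuted by T
  Ref : SentSet → SentSet
  Ref T φ = T ⊩ ¬' φ

  _⊆ₘ_ : SentSet → SentSet → Set
  A ⊆ₘ B = ∀ a → A a → ∃[ b ] (B b × (b ⊢₁ a))

  Mcl : SentSet → SentSet
  Mcl B φ = ∃[ ψ ] (B ψ × (ψ ⊢₁ φ))

  Ncl : SentSet → SentSet
  Ncl B φ = ∃[ ψ ] (B ψ × (ψ ⊢₁ ¬' φ))

  Inconsistent : Sentence → Set
  Inconsistent ψ = ψ ⊢₁ ⊥'

  MonoConsistent : SentSet → Set
  MonoConsistent B = ∀ ψ → B ψ → Inconsistent ψ → ⊥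

  conj : Sentence → List Sentence → Sentence
  conj φ []       = φ
  conj φ (ψ ∷ ψs) = φ ∧ conj ψ ψs

  Hat : SentSet → SentSet
  Hat U χ = ∃[ φ ] ∃[ φs ] (U φ × All U φs × (χ ≡ conj φ φs))

  _⋓_ : SentSet → SentSet → SentSet
  (A ⋓ B) χ = ∃[ φ ] ∃[ ψ ] (A φ × B ψ × (χ ≡ φ ∧ ψ))

  _⋐_ : SentSet → SentSet → Set
  U ⋐ V = (U ⋓ V) ⊆ₘ V

  WeaklyBiseparate : SentSet → SentSet → SentSet → SentSet → Set
  WeaklyBiseparate Z W A B =
    (A ⊆ Z) × (B ⊆ W) × (∀ φ → Z φ → B φ → ⊥) × (∀ φ → W φ → A φ → ⊥)

  -- a theory: a non-empty set of sentences
  NonEmpty : SentSet → Set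
  NonEmpty T = ∃[ φ ] T φ

-- Everything rests on one observation: if U ⋐ V then U_p ⋐ V. A proof of t from u₁, …, uₖ ∈ U is
-- replayed inside a single element of V by absorbing the uᵢ one at a time, each absorption
-- replacing the current element v of V by some v' ∈ V with v' ⊢ uᵢ ∧ v. Parts (a)–(c) then
-- follow by cut, and disjointness in (b) because a theorem of U conjoined with a sentence of V
-- that refutes it would be absorbed into an inconsistent element of V.
module Submission where

open import Defs
open import Data.List using (List; []; _∷_; [_]; map)
open import Data.List.Relation.Binary.Subset.Propositional using () renaming (_⊆_ to _⊆ˡ_)
open import Data.List.Relation.Binary.Subset.Propositional.Properties using (map⁺; ∷⁺ʳ; xs⊆x∷xs)
open import Data.List.Relation.Unary.All as All using (All; []; _∷_)
open import Data.List.Relation.Unary.Any using (here; there)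
open import Data.Product using (_×_; ∃-syntax; _,_)
open import Relation.Binary.PropositionalEquality using (refl)
open import Relation.Nullary using (¬_)
open import Relation.Unary using (_⊆_; _≐_)

module Derivability (L : Signature) where
  open FOL L

  weaken : ∀ {n} {Γ Δ : List (Formula n)} {φ} → Γ ⊆ˡ Δ → Γ ⊢ φ → Δ ⊢ φ
  weaken ρ (hyp x)        = hyp (ρ x)
  weaken ρ (⊥E d)         = ⊥E (weaken ρ d)
  weaken ρ (raa d)        = raa (weaken (∷⁺ʳ _ ρ) d)
  weaken ρ (⇒I d)         = ⇒I (weaken (∷⁺ʳ _ ρ) d)
  weaken ρ (⇒E d e)       = ⇒E (weaken ρ d) (weaken ρ e)
  weaken ρ (∧I d e)       = ∧I (weaken ρ d) (weaken ρ e)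
  weaken ρ (∧E₁ d)        = ∧E₁ (weaken ρ d)
  weaken ρ (∧E₂ d)        = ∧E₂ (weaken ρ d)
  weaken ρ (∨I₁ d)        = ∨I₁ (weaken ρ d)
  weaken ρ (∨I₂ d)        = ∨I₂ (weaken ρ d)
  weaken ρ (∨E d e f)     = ∨E (weaken ρ d) (weaken (∷⁺ʳ _ ρ) e) (weaken (∷⁺ʳ _ ρ) f)
  weaken ρ (∀I d)         = ∀I (weaken (map⁺ wk ρ) d)
  weaken ρ (∀E d t)       = ∀E (weaken ρ d) t
  weaken ρ (∃I t d)       = ∃I t (weaken ρ d)
  weaken ρ (∃E d e)       = ∃E (weaken ρ d) (weaken (∷⁺ʳ _ (map⁺ wk ρ)) e)
  weaken ρ ≐refl          = ≐refl
  weaken ρ (≐subst d e)   = ≐subst (weaken ρ d) (weaken ρ e)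

  -- Cut is obtained through the deduction theorem rather than by substituting derivations,
  -- which would have to commute with the weakening under ∀I and ∃E.
  closure : ∀ {n} → List (Formula n) → Formula n → Formula n
  closure []      φ = φ
  closure (δ ∷ Δ) φ = closure Δ (δ ⇒ φ)

  ⊢-closure : ∀ {n} (Δ : List (Formula n)) {φ} → Δ ⊢ φ → [] ⊢ closure Δ φ
  ⊢-closure []      d = d
  ⊢-closure (δ ∷ Δ) d = ⊢-closure Δ (⇒I d)

  closure-⇒E : ∀ {n} {Γ : List (Formula n)} Δ {φ} → Γ ⊢ closure Δ φ → All (Γ ⊢_) Δ → Γ ⊢ φ
  closure-⇒E []      d []       = d
  closure-⇒E (δ ∷ Δ) d (e ∷ es) = ⇒E (closure-⇒E Δ d es) e

  cut : ∀ {n} {Γ Δ : List (Formula n)} {φ} → All (Γ ⊢_) Δ → Δ ⊢ φ → Γ ⊢ φ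
  cut {Δ = Δ} es d = closure-⇒E Δ (weaken (λ ()) (⊢-closure Δ d)) es

  ⊢₁-refl : ∀ {φ} → φ ⊢₁ φ
  ⊢₁-refl = hyp (here refl)

  ⊢₁-trans : ∀ {φ ψ χ} → φ ⊢₁ ψ → ψ ⊢₁ χ → φ ⊢₁ χ
  ⊢₁-trans d e = cut (d ∷ []) e

  ⊢-conj : ∀ φ φs → (φ ∷ φs) ⊢ conj φ φs
  ⊢-conj φ []       = hyp (here refl)
  ⊢-conj φ (ψ ∷ ψs) = ∧I (hyp (here refl)) (weaken (xs⊆x∷xs _ φ) (⊢-conj ψ ψs))

module Absorption (L : Signature) where
  open FOL L
  open Derivability L

  Hat⊆Thm : ∀ U → Hat U ⊆ Thm U
  Hat⊆Thm U (φ , φs , φ∈U , φs⊆U , refl) = φ ∷ φs , φ∈U ∷ φs⊆U , ⊢-conj φ φs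

  Mcl⊆Thm : ∀ U → Mcl U ⊆ Thm U
  Mcl⊆Thm U (ψ , ψ∈U , d) = [ ψ ] , ψ∈U ∷ [] , d

  ⋓-self⊆Thm : ∀ U → (U ⋓ U) ⊆ Thm U
  ⋓-self⊆Thm U (φ , ψ , φ∈U , ψ∈U , refl) =
    φ ∷ ψ ∷ [] , φ∈U ∷ ψ∈U ∷ [] , ∧I (hyp (here refl)) (hyp (there (here refl)))

  ⊆ₘ-⋓ : ∀ A V → NonEmpty V → A ⊆ₘ (A ⋓ V)
  ⊆ₘ-⋓ A V (v , v∈V) a a∈A = a ∧ v , (a , v , a∈A , v∈V , refl) , ∧E₁ ⊢₁-refl

  ⋐⇒⊆Mcl : ∀ A V → NonEmpty V → A ⋐ V → A ⊆ Mcl V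
  ⋐⇒⊆Mcl A V (v , v∈V) A⋐V {a} a∈A with A⋐V (a ∧ v) (a , v , a∈A , v∈V , refl)
  ... | w , w∈V , d = w , w∈V , ∧E₁ d

  ⋐-absorbAll : ∀ {U V} → U ⋐ V → ∀ Δ → All U Δ → ∀ ψ → V ψ →
                ∃[ v ] (V v × (v ⊢₁ ψ) × All ([ v ] ⊢_) Δ)
  ⋐-absorbAll U⋐V []      []         ψ ψ∈V = ψ , ψ∈V , ⊢₁-refl , []
  ⋐-absorbAll U⋐V (δ ∷ Δ) (δ∈U ∷ Δ⊆U) ψ ψ∈V with ⋐-absorbAll U⋐V Δ Δ⊆U ψ ψ∈V
  ... | v , v∈V , v⊢ψ , v⊢Δ with U⋐V (δ ∧ v) (δ , v , δ∈U , v∈V , refl)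
  ... | w , w∈V , w⊢δ∧v =
    w , w∈V , ⊢₁-trans (∧E₂ w⊢δ∧v) v⊢ψ , ∧E₁ w⊢δ∧v ∷ All.map (⊢₁-trans (∧E₂ w⊢δ∧v)) v⊢Δ

  ⋐-Thm : ∀ {U V} → U ⋐ V → Thm U ⋐ V
  ⋐-Thm U⋐V _ (t , ψ , (Δ , Δ⊆U , Δ⊢t) , ψ∈V , refl) with ⋐-absorbAll U⋐V Δ Δ⊆U ψ ψ∈V
  ... | v , v∈V , v⊢ψ , v⊢Δ = v , v∈V , ∧I (cut v⊢Δ Δ⊢t) v⊢ψ

  ⋐-consistent : ∀ {A V} → A ⋐ V → MonoConsistent V →
                 ∀ {a v} → A a → V v → ¬ Inconsistent (a ∧ v)
  ⋐-consistent A⋐V V-consistent {a} {v} a∈A v∈V a∧v⊢⊥ with A⋐V (a ∧ v) (a , v , a∈A , v∈V , refl)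
  ... | w , w∈V , w⊢a∧v = V-consistent w w∈V (⊢₁-trans w⊢a∧v a∧v⊢⊥)

  ⋐⇒WeaklyBiseparate : ∀ U V → NonEmpty V → U ⋐ V → MonoConsistent V →
                       WeaklyBiseparate (Mcl V) (Ncl V) (Thm U) (Ref U)
  ⋐⇒WeaklyBiseparate U V V≠∅ U⋐V V-consistent =
      Thm⊆Mcl
    , Thm⊆Mcl  -- Ref U φ and Ncl V φ unfold to Thm U (¬' φ) and Mcl V (¬' φ)
    , (λ { φ (v , v∈V , v⊢φ) ⊢¬φ →
           consistent ⊢¬φ v∈V (⇒E (∧E₁ ⊢₁-refl) (⊢₁-trans (∧E₂ ⊢₁-refl) v⊢φ)) })
    , (λ { φ (v , v∈V , v⊢¬φ) ⊢φ →
           consistent ⊢φ v∈V (⇒E (⊢₁-trans (∧E₂ ⊢₁-refl) v⊢¬φ) (∧E₁ ⊢₁-refl)) })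
    where
    Thm⊆Mcl : Thm U ⊆ Mcl V
    Thm⊆Mcl = ⋐⇒⊆Mcl (Thm U) V V≠∅ (⋐-Thm U⋐V)

    consistent : ∀ {t v} → Thm U t → V v → ¬ Inconsistent (t ∧ v)
    consistent = ⋐-consistent (⋐-Thm U⋐V) V-consistent

open Absorption

theorem2p2 : (L : Signature) → let open FOL L in
    (U V : SentSet) → NonEmpty U → NonEmpty V →
      (U ⋐ V → (Hat U ⊆ Thm U) × (Thm U ⊆ₘ (Thm U ⋓ V)) × ((Thm U ⋓ V) ⊆ₘ V))
      × (U ⋐ V → MonoConsistent V → WeaklyBiseparate (Mcl V) (Ncl V) (Thm U) (Ref U))
      × ((U ⋐ U → Mcl U ≐ Thm U) × (Mcl U ≐ Thm U → U ⋐ U))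
theorem2p2 L U V U≠∅ V≠∅ =
    (λ U⋐V → Hat⊆Thm L U , ⊆ₘ-⋓ L (Thm U) V V≠∅ , ⋐-Thm L U⋐V)
  , ⋐⇒WeaklyBiseparate L U V V≠∅
  , (λ U⋐U → Mcl⊆Thm L U , ⋐⇒⊆Mcl L (Thm U) U U≠∅ (⋐-Thm L U⋐U))
  , λ { (_ , Thm⊆Mcl) χ χ∈U⋓U → Thm⊆Mcl (⋓-self⊆Thm L U χ∈U⋓U) }
  where open FOL L using (Thm)
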